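{- Let $\mathcal{C}$ be a CwF satisfying condition (LF): the underlying category of $\mathcal{C}$ has finite products, and for all maps $Z\xrightarrow{g}Y\xrightarrow{f}X$ with $f$ a display map and $g$ either a display map or a product projection, the dependent exponential $\Pi[f,g]$ exists. Then the local universe model $\mathcal{C}_!$ has familially representable polynomial sorts: for every closed polynomial sort $P$ of $\mathcal{C}_!$, the presheaf $\mathsf{Elem}(P)$ is familially representable.
   Context: A CwF consists of a category with terminal object $\diamond$, a presheaf $\mathsf{Ty}$ of types, sets $\mathsf{Tm}(\Gamma,A)$ of terms with functorial substitution, and context extensions $\Gamma.A$ with $\mathbf{p}_A:\Gamma.A\to\Gamma$ and $\mathbf{q}_A\in\mathsf{Tm}(\Gamma.A,A[\mathbf{p}_A])$ such that maps $\Delta\to\Gamma.A$ correspond bijectively to pairs $(\rho:\Delta\to\Gamma,\ a\in\mathsf{Tm}(\Delta,A[\rho]))$. A display map is a finite composite of projections $\mathbf{p}_A$ (equivalently a projection $\Gamma.\Delta\to\Gamma$ for a telescope $\Delta$ over $\Gamma$); pullbacks along display maps exist (given by substitution). For $f:Y\to X$ and $g:Z\to Y$, the dependent exponential $\Pi[f,g]$ is an object over $X$ (the value at $g$ of a right adjoint to pullback along $f$), i.e. a map $\Pi[f,g]\to X$ such that maps $h:W\to\Pi[f,g]$ correspond naturally to pairs of a map $h':W\to X$ and a map $W\times_X Y\to Z$ over $Y$. Local universe model $\mathcal{C}_!$: same underlying category as $\mathcal{C}$; a type of $\mathcal{C}_!$ over $\Gamma$ is a triple $(V,E,\chi)$ with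 $V$ an object, $E\in\mathsf{Ty}_{\mathcal{C}}(V)$ and $\chi:\Gamma\to V$, substitution acting by precomposition on $\chi$; terms are $\mathsf{Tm}_!(\Gamma,(V,E,\chi))=\mathsf{Tm}_{\mathcal{C}}(\Gamma,E[\chi])$, with context extension $\Gamma.E[\chi]$. Familial representability: a presheaf is familially representable if every connected component of its category of elements has a terminal object. Polynomial sorts of a CwF: a monomial sort over $\Gamma$ is $[\Delta\vdash\mathbb{ty}]$ or $[\Delta\vdash\mathbb{tm}(A)]$ with $\Delta$ a telescope over $\Gamma$ and $A\in\mathsf{Ty}(\Gamma.\Delta)$, with elements $\mathsf{Ty}(\Gamma.\Delta)$, resp. $\mathsf{Tm}(\Gamma.\Delta,A)$. Closed polynomial sorts and $\mathsf{Elem}$ are defined inductively: $\diamond$ with $\mathsf{Elem}(\diamond)$ terminal; $P.M$ where $M$ assigns naturally to each $e\in\mathsf{Elem}(P)(\Gamma)$ a monomial sort $M(e)$ over $\Gamma$, and $\mathsf{Elem}(P.M)(\Gamma)=\{(e,m):e\in\mathsf{Elem}(P)(\Gamma),\ m\text{ an element of }M(e)\}$. -}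

module Defs where

open import Level using (Level; suc)
open import Data.Unit.Polymorphic using (⊤; tt)
open import Data.Product using (Σ; _×_; _,_; proj₁; proj₂)
open import Data.Sum using (_⊎_)
open import Relation.Binary.PropositionalEquality
  using (_≡_; refl; sym; trans; cong; subst)
open import Relation.Binary.Construct.Closure.Equivalence using (EqClosure)

Unique : ∀ {a b} {A : Set a} → (A → Set b) → Set _
Unique {A = A} P = Σ A (λ x → P x × (∀ y → P y → y ≡ x))

-- Polynomial sorts only refer to these.

record CwFStr (ℓ : Level) : Set (suc ℓ) where
  infixl 9 _∘_
  infixl 8 _[_]T _[_]t
  infixl 5 _▹_
  field
    Ctx   : Set ℓ
    Hom   : Ctx → Ctx → Set ℓ
    id    : ∀ {Γ} → Hom Γ Γ
    _∘_   : ∀ {Γ Δ Θ} → Hom Δ Γ → Hom Θ Δ → Hom Θ Γ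
    idl   : ∀ {Γ Δ} {f : Hom Δ Γ} → id ∘ f ≡ f
    idr   : ∀ {Γ Δ} {f : Hom Δ Γ} → f ∘ id ≡ f
    assoc : ∀ {Γ Δ Θ Ξ} {f : Hom Δ Γ} {g : Hom Θ Δ} {h : Hom Ξ Θ}
          → (f ∘ g) ∘ h ≡ f ∘ (g ∘ h)
    ◇     : Ctx
    !     : ∀ {Γ} → Hom Γ ◇
    !-η   : ∀ {Γ} (f : Hom Γ ◇) → f ≡ !
    Ty    : Ctx → Set ℓ
    _[_]T : ∀ {Γ Δ} → Ty Γ → Hom Δ Γ → Ty Δ
    [id]T : ∀ {Γ} {A : Ty Γ} → A [ id ]T ≡ A
    [∘]T  : ∀ {Γ Δ Θ} {A : Ty Γ} {σ : Hom Δ Γ} {τ : Hom Θ Δ}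
          → A [ σ ∘ τ ]T ≡ A [ σ ]T [ τ ]T
    Tm    : (Γ : Ctx) → Ty Γ → Set ℓ
    _[_]t : ∀ {Γ Δ} {A : Ty Γ} → Tm Γ A → (σ : Hom Δ Γ) → Tm Δ (A [ σ ]T)
    _▹_   : (Γ : Ctx) → Ty Γ → Ctx
    p     : ∀ {Γ} {A : Ty Γ} → Hom (Γ ▹ A) Γ
    q     : ∀ {Γ} {A : Ty Γ} → Tm (Γ ▹ A) (A [ p ]T)
    ⟨_,_⟩ : ∀ {Γ Δ} {A : Ty Γ} (σ : Hom Δ Γ) → Tm Δ (A [ σ ]T) → Hom Δ (Γ ▹ A)

record CwF (ℓ : Level) : Set (suc ℓ) where
  field
    str : CwFStr ℓ
  open CwFStr str
  field
    [id]t : ∀ {Γ} {A : Ty Γ} (t : Tm Γ A) → subst (Tm Γ) [id]T (t [ id ]t) ≡ t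
    [∘]t  : ∀ {Γ Δ Θ} {A : Ty Γ} (t : Tm Γ A) (σ : Hom Δ Γ) (τ : Hom Θ Δ)
          → subst (Tm Θ) [∘]T (t [ σ ∘ τ ]t) ≡ t [ σ ]t [ τ ]t
    p∘⟨⟩  : ∀ {Γ Δ} {A : Ty Γ} (σ : Hom Δ Γ) (a : Tm Δ (A [ σ ]T))
          → p ∘ ⟨ σ , a ⟩ ≡ σ
    q[⟨⟩] : ∀ {Γ Δ} {A : Ty Γ} (σ : Hom Δ Γ) (a : Tm Δ (A [ σ ]T))
          → subst (Tm Δ) (trans (sym [∘]T) (cong (A [_]T) (p∘⟨⟩ σ a)))
                  (q [ ⟨ σ , a ⟩ ]t) ≡ a
    ⟨⟩-η  : ∀ {Γ Δ} {A : Ty Γ} (h : Hom Δ (Γ ▹ A))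
          → h ≡ ⟨ p ∘ h , subst (Tm Δ) (sym [∘]T) (q [ h ]t) ⟩

module Cat {ℓ} (S : CwFStr ℓ) where
  open CwFStr S

  IsTerminal : Ctx → Set ℓ
  IsTerminal T = ∀ Γ → Unique (λ (f : Hom Γ T) → ⊤ {ℓ})

  IsProduct : ∀ {X Y Z} → Hom Z X → Hom Z Y → Set ℓ
  IsProduct {X} {Y} {Z} π₁ π₂ =
    ∀ {T} (a : Hom T X) (b : Hom T Y) → Unique (λ (m : Hom T Z) → (π₁ ∘ m ≡ a) × (π₂ ∘ m ≡ b))

  HasFiniteProducts : Set ℓ
  HasFiniteProducts =
    Σ Ctx IsTerminal ×
    (∀ X Y → Σ Ctx λ Z → Σ (Hom Z X) λ π₁ → Σ (Hom Z Y) λ π₂ → IsProduct π₁ π₂)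

  IsProductProjection : ∀ {Y Z} → Hom Z Y → Set ℓ
  IsProductProjection {Y} {Z} g = Σ Ctx λ W → Σ (Hom Z W) λ g' → IsProduct g g'

  IsPullback : ∀ {X Y W P} → Hom Y X → Hom W X → Hom P W → Hom P Y → Set ℓ
  IsPullback {X} {Y} {W} {P} f h u v =
    (h ∘ u ≡ f ∘ v) ×
    (∀ {T} (a : Hom T W) (b : Hom T Y) → h ∘ a ≡ f ∘ b
       → Unique (λ (m : Hom T P) → (u ∘ m ≡ a) × (v ∘ m ≡ b)))

  data Disp (X : Ctx) : Ctx → Set ℓ where
    done : Disp X X
    step : ∀ {Y} → Disp X Y → (A : Ty Y) → Disp X (Y ▹ A)

  dmap : ∀ {X Y} → Disp X Y → Hom Y X
  dmap done       = id
  dmap (step d A) = dmap d ∘ p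

  IsDisplay : ∀ {X Y} → Hom Y X → Set ℓ
  IsDisplay {X} {Y} f = Σ (Disp X Y) λ d → dmap d ≡ f

  -- The dependent exponential Π[f,g] (f : Y → X, g : Z → Y) exists:
  -- an object Π over X (π : Π → X) with a pullback Π ×_X Y (u, v) and
  -- a map ev : Π ×_X Y → Z over Y, such that h ↦ (π ∘ h , ev ∘ (h ×_X Y))
  -- is a bijection between maps W → Π and pairs (h' : W → X,
  -- k : W ×_X Y → Z over Y), for every pullback W ×_X Y of f along h'.
  HasDepExp : ∀ {X Y Z} → Hom Y X → Hom Z Y → Set ℓ
  HasDepExp {X} {Y} {Z} f g =
    Σ Ctx λ Π → Σ (Hom Π X) λ π →
    Σ Ctx λ PB → Σ (Hom PB Π) λ u → Σ (Hom PB Y) λ v →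
    Σ (IsPullback f π u v) λ _ →
    Σ (Hom PB Z) λ ev → (g ∘ ev ≡ v) ×
    (∀ {W} (h' : Hom W X) {P} (u' : Hom P W) (v' : Hom P Y)
       → IsPullback f h' u' v'
       → (k : Hom P Z) → g ∘ k ≡ v'
       → Unique (λ (h : Hom W Π) →
            (π ∘ h ≡ h') ×
            (∀ (m : Hom P PB) → u ∘ m ≡ h ∘ u' → v ∘ m ≡ v' → ev ∘ m ≡ k)))

  LF : Set ℓ
  LF = HasFiniteProducts ×
       (∀ {X Y Z} (f : Hom Y X) (g : Hom Z Y) → IsDisplay f
          → (IsDisplay g ⊎ IsProductProjection g) → HasDepExp f g)

module _ {ℓ} (C : CwF ℓ) where
  open CwF C using (str)
  open CwFStr str

  record LTy (Γ : Ctx) : Set ℓ where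
    constructor ltyp
    field
      V : Ctx
      E : Ty V
      χ : Hom Γ V

  LocalUniverse : CwFStr ℓ
  LocalUniverse = record
    { Ctx = Ctx ; Hom = Hom ; id = id ; _∘_ = _∘_
    ; idl = idl ; idr = idr ; assoc = assoc
    ; ◇ = ◇ ; ! = ! ; !-η = !-η
    ; Ty = LTy
    ; _[_]T = λ { (ltyp V E χ) σ → ltyp V E (χ ∘ σ) }
    ; [id]T = λ { {A = ltyp V E χ} → cong (ltyp V E) idr }
    ; [∘]T = λ { {A = ltyp V E χ} → cong (ltyp V E) (sym assoc) }
    ; Tm = λ { Γ (ltyp V E χ) → Tm Γ (E [ χ ]T) }
    ; _[_]t = λ { {Δ = Δ} {A = ltyp V E χ} t σ → subst (Tm Δ) (sym [∘]T) (t [ σ ]t) }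
    ; _▹_ = λ { Γ (ltyp V E χ) → Γ ▹ (E [ χ ]T) }
    ; p = λ { {A = ltyp V E χ} → p }
    ; q = λ { {A = ltyp V E χ} → subst (Tm _) (sym [∘]T) q }
    ; ⟨_,_⟩ = λ { {Δ = Δ} {A = ltyp V E χ} σ a → ⟨ σ , subst (Tm Δ) [∘]T a ⟩ }
    }

module Poly {ℓ} (S : CwFStr ℓ) where
  open CwFStr S

  data Tele (Γ : Ctx) : Set ℓ
  _▹▹_ : (Γ : Ctx) → Tele Γ → Ctx

  data Tele Γ where
    []   : Tele Γ
    _,,_ : (Δ : Tele Γ) → Ty (Γ ▹▹ Δ) → Tele Γ

  Γ ▹▹ []       = Γ
  Γ ▹▹ (Δ ,, A) = (Γ ▹▹ Δ) ▹ A

  _[_]Tel : ∀ {Γ Θ} → Tele Γ → Hom Θ Γ → Tele Θ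
  lift    : ∀ {Γ Θ} (Δ : Tele Γ) (σ : Hom Θ Γ) → Hom (Θ ▹▹ (Δ [ σ ]Tel)) (Γ ▹▹ Δ)
  [] [ σ ]Tel       = []
  (Δ ,, A) [ σ ]Tel = (Δ [ σ ]Tel) ,, (A [ lift Δ σ ]T)
  lift []       σ = σ
  lift (Δ ,, A) σ = ⟨ lift Δ σ ∘ p , subst (Tm _) (sym [∘]T) q ⟩

  data Mono (Γ : Ctx) : Set ℓ where
    ty : Tele Γ → Mono Γ
    tm : (Δ : Tele Γ) → Ty (Γ ▹▹ Δ) → Mono Γ

  Els : ∀ {Γ} → Mono Γ → Set ℓ
  Els {Γ} (ty Δ)   = Ty (Γ ▹▹ Δ)
  Els {Γ} (tm Δ A) = Tm (Γ ▹▹ Δ) A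

  _[_]M : ∀ {Γ Θ} → Mono Γ → Hom Θ Γ → Mono Θ
  ty Δ   [ σ ]M = ty (Δ [ σ ]Tel)
  tm Δ A [ σ ]M = tm (Δ [ σ ]Tel) (A [ lift Δ σ ]T)

  _[_]E : ∀ {Γ Θ} {M : Mono Γ} → Els M → (σ : Hom Θ Γ) → Els (M [ σ ]M)
  _[_]E {M = ty Δ}   B σ = B [ lift Δ σ ]T
  _[_]E {M = tm Δ A} t σ = t [ lift Δ σ ]t

  data PolySort : Set ℓ
  Elem : PolySort → Ctx → Set ℓ
  act  : (P : PolySort) → ∀ {Γ Δ} → Elem P Γ → Hom Δ Γ → Elem P Δ

  data PolySort where
    ◆   : PolySort
    ext : (P : PolySort) (M : ∀ {Γ} → Elem P Γ → Mono Γ)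
        → (∀ {Γ Δ} (e : Elem P Γ) (σ : Hom Δ Γ) → M (act P e σ) ≡ M e [ σ ]M)
        → PolySort

  Elem ◆ Γ           = ⊤
  Elem (ext P M _) Γ = Σ (Elem P Γ) λ e → Els (M e)

  act ◆ _ _                     = tt
  act (ext P M nat) (e , m) σ   = act P e σ , subst Els (sym (nat e σ)) (_[_]E {M = M e} m σ)

module _ {ℓ} {Ob : Set ℓ} (Hom : Ob → Ob → Set ℓ) (F : Ob → Set ℓ)
         (act : ∀ {Γ Δ} → F Γ → Hom Δ Γ → F Δ) where

  Elt : Set ℓ
  Elt = Σ Ob F

  EltHom : Elt → Elt → Set ℓ
  EltHom (Δ , y) (Γ , x) = Σ (Hom Δ Γ) λ σ → act x σ ≡ y

  SameComponent : Elt → Elt → Set ℓ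
  SameComponent = EqClosure EltHom

  -- every connected component has a terminal object
  FamiliallyRepresentable : Set ℓ
  FamiliallyRepresentable =
    ∀ (x : Elt) → Σ Elt λ t → SameComponent x t ×
      (∀ (y : Elt) → SameComponent y t →
         Σ (EltHom y t) λ f → ∀ (f' : EltHom y t) → proj₁ f' ≡ proj₁ f)

module Submission where

-- We pick, for every element, a terminal object of its connected component,
-- invariantly along morphisms of elements, by induction on P. For ◆ this is
-- the terminal object ◇. For P.M, an element (e , m) over Γ is sent by σ to the
-- terminal (T , t) of the component of e, and m becomes an element of M(t)[σ].
-- In the local universe model each monomial sort over T has, for each shape
-- (the local universe (V , E) of a type; a single shape for terms), a generic
-- element over some π : T' → T classifying all elements of that shape:
-- T' = Π[p_Δ, pr₁] with pr₁ : T.Δ × V → T.Δ for [Δ ⊢ ty], and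
-- T' = Π[p_Δ, p_{E[χ]}] for [Δ ⊢ tm (V , E , χ)]. This uses that Γ.Δ[σ] is the
-- pullback of p_Δ along σ. Shapes are stable under substitution, so the generic
-- element at the shape of m is terminal in the component of (e , m).

open import Defs
open import Data.Unit.Polymorphic using (⊤; tt)
open import Data.Product using (Σ; _×_; _,_; proj₁; proj₂)
open import Data.Sum using (inj₁; inj₂)
open import Relation.Binary.PropositionalEquality
open import Relation.Binary.Construct.Closure.Equivalence using (gfold)
open import Relation.Binary.Construct.Closure.Symmetric using (fwd)
open import Relation.Binary.Construct.Closure.ReflexiveTransitive using (ε; _◅_)

module _ {ℓ} {Ob : Set ℓ} (Hom : Ob → Ob → Set ℓ) (F : Ob → Set ℓ)
         (act : ∀ {Γ Δ} → F Γ → Hom Δ Γ → F Δ) where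

  record ComponentTerminals : Set ℓ where
    field
      terminal          : Elt Hom F act → Elt Hom F act
      toTerminal        : ∀ x → EltHom Hom F act x (terminal x)
      toTerminal-unique : ∀ x (f : EltHom Hom F act x (terminal x))
                        → proj₁ f ≡ proj₁ (toTerminal x)
      terminal-resp     : ∀ {x y} → EltHom Hom F act x y → terminal x ≡ terminal y

  componentTerminals⇒familiallyRepresentable :
    ComponentTerminals → FamiliallyRepresentable Hom F act
  componentTerminals⇒familiallyRepresentable terminals x =
    terminal x , fwd (toTerminal x) ◅ ε , λ y y~tx →
      toTerminalOf y (trans (gfold {R = EltHom Hom F act} isEquivalence terminal terminal-resp y~tx)
                            (sym (terminal-resp (toTerminal x))))
    where
    open ComponentTerminals terminals
    toTerminalOf : ∀ y {t} → terminal y ≡ t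
                 → Σ (EltHom Hom F act y t) λ f
                   → ∀ (f' : EltHom Hom F act y t) → proj₁ f' ≡ proj₁ f
    toTerminalOf y refl = toTerminal y , toTerminal-unique y

-- Hom and Tm are not injective in their indices, so these heterogeneous
-- equalities keep the indices visible to let matching on hrefl identify them.

module CwFEquality {ℓ} (C : CwF ℓ) where
  open CwF C
  open CwFStr str

  infix 4 _≅ₜ_ _≅ₕ_

  data _≅ₜ_ {Γ} {A : Ty Γ} (a : Tm Γ A) : ∀ {Γ'} {A' : Ty Γ'} → Tm Γ' A' → Set ℓ where
    hrefl : a ≅ₜ a

  data _≅ₕ_ {Δ Γ} (f : Hom Δ Γ) : ∀ {Δ' Γ'} → Hom Δ' Γ' → Set ℓ where
    hrefl : f ≅ₕ f

  ≅ₜ-sym : ∀ {Γ Γ'} {A : Ty Γ} {A' : Ty Γ'} {a : Tm Γ A} {a' : Tm Γ' A'} → a ≅ₜ a' → a' ≅ₜ a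
  ≅ₜ-sym hrefl = hrefl

  ≅ₜ-trans : ∀ {Γ Γ' Γ''} {A : Ty Γ} {A' : Ty Γ'} {A'' : Ty Γ''}
               {a : Tm Γ A} {a' : Tm Γ' A'} {a'' : Tm Γ'' A''}
           → a ≅ₜ a' → a' ≅ₜ a'' → a ≅ₜ a''
  ≅ₜ-trans hrefl p = p

  ≡⇒≅ₜ : ∀ {Γ} {A : Ty Γ} {a a' : Tm Γ A} → a ≡ a' → a ≅ₜ a'
  ≡⇒≅ₜ refl = hrefl

  subst-≅ₜ : ∀ {Γ} {A A' : Ty Γ} (e : A ≡ A') (a : Tm Γ A) → subst (Tm Γ) e a ≅ₜ a
  subst-≅ₜ refl a = hrefl

  ≅ₕ-sym : ∀ {Δ Γ Δ' Γ'} {f : Hom Δ Γ} {f' : Hom Δ' Γ'} → f ≅ₕ f' → f' ≅ₕ f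
  ≅ₕ-sym hrefl = hrefl

  ≅ₕ-trans : ∀ {Δ Γ Δ' Γ' Δ'' Γ''} {f : Hom Δ Γ} {f' : Hom Δ' Γ'} {f'' : Hom Δ'' Γ''}
           → f ≅ₕ f' → f' ≅ₕ f'' → f ≅ₕ f''
  ≅ₕ-trans hrefl p = p

  ≅ₕ⇒≡ : ∀ {Δ Γ} {f f' : Hom Δ Γ} → f ≅ₕ f' → f ≡ f'
  ≅ₕ⇒≡ hrefl = refl

  ≡⇒≅ₕ : ∀ {Δ Γ} {f f' : Hom Δ Γ} → f ≡ f' → f ≅ₕ f'
  ≡⇒≅ₕ refl = hrefl

  subst-dom-≅ₕ : ∀ {a} {I : Set a} (F : I → Ctx) {X} {i j} (e : i ≡ j) (f : Hom (F i) X)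
               → subst (λ i → Hom (F i) X) e f ≅ₕ f
  subst-dom-≅ₕ F refl f = hrefl

  ∘-cong-≅ₕ : ∀ {X Y Z X' Y' Z'} {f : Hom Y Z} {f' : Hom Y' Z'} {g : Hom X Y} {g' : Hom X' Y'}
            → f ≅ₕ f' → g ≅ₕ g' → f ∘ g ≅ₕ f' ∘ g'
  ∘-cong-≅ₕ hrefl hrefl = hrefl

  []t-cong : ∀ {X X' Y Y'} {t : Tm X Y} {t' : Tm X' Y'} {Z Z'} {h : Hom Z X} {h' : Hom Z' X'}
           → t ≅ₜ t' → h ≅ₕ h' → t [ h ]t ≅ₜ t' [ h' ]t
  []t-cong hrefl hrefl = hrefl

  [∘]t-≅ₜ : ∀ {Γ Δ Θ} {A : Ty Γ} (t : Tm Γ A) (σ : Hom Δ Γ) (τ : Hom Θ Δ)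
          → t [ σ ∘ τ ]t ≅ₜ t [ σ ]t [ τ ]t
  [∘]t-≅ₜ t σ τ = ≅ₜ-trans (≅ₜ-sym (subst-≅ₜ [∘]T (t [ σ ∘ τ ]t))) (≡⇒≅ₜ ([∘]t t σ τ))

  q[⟨⟩]-≅ₜ : ∀ {Γ Δ} {A : Ty Γ} (σ : Hom Δ Γ) (a : Tm Δ (A [ σ ]T)) → q [ ⟨ σ , a ⟩ ]t ≅ₜ a
  q[⟨⟩]-≅ₜ σ a = ≅ₜ-trans (≅ₜ-sym (subst-≅ₜ _ _)) (≡⇒≅ₜ (q[⟨⟩] σ a))

  ⟨⟩-cong : ∀ {Γ Δ} {A : Ty Γ} {σ σ' : Hom Δ Γ} {a : Tm Δ (A [ σ ]T)} {a' : Tm Δ (A [ σ' ]T)}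
          → σ ≡ σ' → a ≅ₜ a' → ⟨ σ , a ⟩ ≡ ⟨ σ' , a' ⟩
  ⟨⟩-cong refl hrefl = refl

  ▹-ext : ∀ {Γ Δ} {A : Ty Γ} (h h' : Hom Δ (Γ ▹ A))
        → p ∘ h ≡ p ∘ h' → q [ h ]t ≅ₜ q [ h' ]t → h ≡ h'
  ▹-ext h h' p-eq q-eq =
    trans (⟨⟩-η h)
      (trans (⟨⟩-cong p-eq (≅ₜ-trans (subst-≅ₜ _ _) (≅ₜ-trans q-eq (≅ₜ-sym (subst-≅ₜ _ _)))))
             (sym (⟨⟩-η h')))

module Telescopes {ℓ} (C : CwF ℓ) where
  open CwF C
  open CwFStr str
  open CwFEquality C
  open Cat str
  open Poly (LocalUniverse C)

  dispTele : ∀ {T} (Δ : Tele T) → Disp T (T ▹▹ Δ)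
  dispTele []       = done
  dispTele (Δ ,, A) = step (dispTele Δ) (LTy.E A [ LTy.χ A ]T)

  pTele : ∀ {T} (Δ : Tele T) → Hom (T ▹▹ Δ) T
  pTele Δ = dmap (dispTele Δ)

  pTele-cong : ∀ {Γ} {D D' : Tele Γ} → D ≡ D' → pTele D ≅ₕ pTele D'
  pTele-cong refl = hrefl

  lift-cong : ∀ {Γ Θ} (Δ : Tele Γ) {σ σ' : Hom Θ Γ} → σ ≡ σ' → lift Δ σ ≅ₕ lift Δ σ'
  lift-cong Δ refl = hrefl

  p∘lift : ∀ {Γ Θ} (Δ : Tele Γ) (A : LTy C (Γ ▹▹ Δ)) (σ : Hom Θ Γ)
         → p ∘ lift (Δ ,, A) σ ≡ lift Δ σ ∘ p
  p∘lift Δ A σ = p∘⟨⟩ _ _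

  q[lift] : ∀ {Γ Θ} (Δ : Tele Γ) (A : LTy C (Γ ▹▹ Δ)) (σ : Hom Θ Γ)
          → q [ lift (Δ ,, A) σ ]t ≅ₜ q {A = LTy.E A [ LTy.χ A ∘ lift Δ σ ]T}
  -- q and ⟨_,_⟩ of C_! are those of C up to transport along [∘]T.
  q[lift] Δ (ltyp V E χ) σ =
    ≅ₜ-trans (q[⟨⟩]-≅ₜ _ _)
    (≅ₜ-trans (subst-≅ₜ ([∘]T {A = E} {σ = χ} {τ = lift Δ σ ∘ p}) _)
    (≅ₜ-trans (substᵁ-≅ₜ (sym (cong (ltyp V E) (sym assoc))) (CwFStr.q (LocalUniverse C)))
              (subst-≅ₜ (sym ([∘]T {A = E} {σ = χ ∘ lift Δ σ} {τ = p})) q)))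
    where
    substᵁ-≅ₜ : ∀ {Γ} {A A' : LTy C Γ} (e : A ≡ A') (a : CwFStr.Tm (LocalUniverse C) Γ A)
              → subst (CwFStr.Tm (LocalUniverse C) Γ) e a ≅ₜ a
    substᵁ-≅ₜ refl a = hrefl

  lift-pullback : ∀ {T Γ} (Δ : Tele T) (σ : Hom Γ T)
                → IsPullback (pTele Δ) σ (pTele (Δ [ σ ]Tel)) (lift Δ σ)
  lift-pullback [] σ =
    trans idr (sym idl) , λ a b e → a , (idl , trans e idl) , λ y (e₁ , _) → trans (sym idl) e₁
  lift-pullback {T} {Γ} (Δ ,, A) σ = commutes , universal
    where
    open LTy A
    pullbackΔ : IsPullback (pTele Δ) σ (pTele (Δ [ σ ]Tel)) (lift Δ σ)
    pullbackΔ = lift-pullback Δ σ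
    lift⁺ : Hom (Γ ▹▹ ((Δ ,, A) [ σ ]Tel)) (T ▹▹ (Δ ,, A))
    lift⁺ = lift (Δ ,, A) σ

    commutes : σ ∘ (pTele (Δ [ σ ]Tel) ∘ p) ≡ (pTele Δ ∘ p) ∘ lift⁺
    commutes = begin
      σ ∘ (pTele (Δ [ σ ]Tel) ∘ p)    ≡⟨ sym assoc ⟩
      (σ ∘ pTele (Δ [ σ ]Tel)) ∘ p    ≡⟨ cong (_∘ p) (proj₁ pullbackΔ) ⟩
      (pTele Δ ∘ lift Δ σ) ∘ p        ≡⟨ assoc ⟩
      pTele Δ ∘ (lift Δ σ ∘ p)        ≡⟨ cong (pTele Δ ∘_) (sym (p∘lift Δ A σ)) ⟩
      pTele Δ ∘ (p ∘ lift⁺)           ≡⟨ sym assoc ⟩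
      (pTele Δ ∘ p) ∘ lift⁺           ∎
      where open ≡-Reasoning

    p∘lift⁺∘ : ∀ {X} (y : Hom X (Γ ▹▹ ((Δ ,, A) [ σ ]Tel))) → p ∘ (lift⁺ ∘ y) ≡ lift Δ σ ∘ (p ∘ y)
    p∘lift⁺∘ y = trans (sym assoc) (trans (cong (_∘ y) (p∘lift Δ A σ)) assoc)

    q[lift⁺∘] : ∀ {X} (y : Hom X (Γ ▹▹ ((Δ ,, A) [ σ ]Tel))) → q [ lift⁺ ∘ y ]t ≅ₜ q [ y ]t
    q[lift⁺∘] y = ≅ₜ-trans ([∘]t-≅ₜ q _ y) ([]t-cong (q[lift] Δ A σ) hrefl)

    universal : ∀ {X} (a : Hom X Γ) (b : Hom X (T ▹▹ (Δ ,, A))) → σ ∘ a ≡ (pTele Δ ∘ p) ∘ b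
              → Unique (λ m → ((pTele (Δ [ σ ]Tel) ∘ p) ∘ m ≡ a) × (lift⁺ ∘ m ≡ b))
    universal {X} a b e = m , (m-a , m-b) , m-unique
      where
      factorΔ : Unique (λ m → (pTele (Δ [ σ ]Tel) ∘ m ≡ a) × (lift Δ σ ∘ m ≡ p ∘ b))
      factorΔ = proj₂ pullbackΔ a (p ∘ b) (trans e assoc)
      m₀ : Hom X (Γ ▹▹ (Δ [ σ ]Tel))
      m₀ = proj₁ factorΔ
      m₀-a : pTele (Δ [ σ ]Tel) ∘ m₀ ≡ a
      m₀-a = proj₁ (proj₁ (proj₂ factorΔ))
      m₀-b : lift Δ σ ∘ m₀ ≡ p ∘ b
      m₀-b = proj₂ (proj₁ (proj₂ factorΔ))
      q[b]-type : E [ χ ]T [ p ]T [ b ]T ≡ E [ χ ∘ lift Δ σ ]T [ m₀ ]T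
      q[b]-type = trans (sym [∘]T) (trans (cong (E [ χ ]T [_]T) (sym m₀-b))
                    (trans [∘]T (cong (_[ m₀ ]T) (sym [∘]T))))
      t : Tm X (E [ χ ∘ lift Δ σ ]T [ m₀ ]T)
      t = subst (Tm X) q[b]-type (q [ b ]t)
      m : Hom X (Γ ▹▹ ((Δ ,, A) [ σ ]Tel))
      m = ⟨ m₀ , t ⟩
      m-a : (pTele (Δ [ σ ]Tel) ∘ p) ∘ m ≡ a
      m-a = trans assoc (trans (cong (pTele (Δ [ σ ]Tel) ∘_) (p∘⟨⟩ m₀ t)) m₀-a)
      m-b : lift⁺ ∘ m ≡ b
      m-b = ▹-ext _ _ (trans (p∘lift⁺∘ m) (trans (cong (lift Δ σ ∘_) (p∘⟨⟩ m₀ t)) m₀-b))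
              (≅ₜ-trans (q[lift⁺∘] m) (≅ₜ-trans (q[⟨⟩]-≅ₜ m₀ t) (subst-≅ₜ q[b]-type _)))
      m-unique : ∀ y → ((pTele (Δ [ σ ]Tel) ∘ p) ∘ y ≡ a) × (lift⁺ ∘ y ≡ b) → y ≡ m
      m-unique y (y-a , y-b) = ▹-ext _ _ (trans p∘y≡m₀ (sym (p∘⟨⟩ m₀ t)))
          (≅ₜ-trans (≅ₜ-sym (q[lift⁺∘] y)) (≅ₜ-trans ([]t-cong hrefl (≡⇒≅ₕ y-b))
            (≅ₜ-trans (≅ₜ-sym (subst-≅ₜ q[b]-type _)) (≅ₜ-sym (q[⟨⟩]-≅ₜ m₀ t)))))
        where
        p∘y≡m₀ : p ∘ y ≡ m₀
        p∘y≡m₀ = proj₂ (proj₂ factorΔ) (p ∘ y)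
                   (trans (sym assoc) y-a , trans (sym (p∘lift⁺∘ y)) (cong (p ∘_) y-b))

  ,,-cong : ∀ {Ξ V} {E : Ty V} {D D' : Tele Ξ} {g : Hom (Ξ ▹▹ D) V} {g' : Hom (Ξ ▹▹ D') V}
          → D ≡ D' → g ≅ₕ g' → (D ,, ltyp V E g) ≡ (D' ,, ltyp V E g')
  ,,-cong refl hrefl = refl

  ▹-ext-≅ₕ : ∀ {Ξ V Y} {E : Ty V} {B : Ty Y} {D₁ D₂ : Tele Ξ} (D-eq : D₁ ≡ D₂)
               {g₁ : Hom (Ξ ▹▹ D₁) V} {g₂ : Hom (Ξ ▹▹ D₂) V} (g-eq : g₁ ≅ₕ g₂)
               {F₁ : Hom (Ξ ▹▹ D₁) Y} {F₂ : Hom (Ξ ▹▹ D₂) Y} (F-eq : F₁ ≅ₕ F₂)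
               (h₁ : Hom ((Ξ ▹▹ D₁) ▹ E [ g₁ ]T) (Y ▹ B)) (h₂ : Hom ((Ξ ▹▹ D₂) ▹ E [ g₂ ]T) (Y ▹ B))
           → p ∘ h₁ ≡ F₁ ∘ p → q [ h₁ ]t ≅ₜ q {A = E [ g₁ ]T}
           → p ∘ h₂ ≡ F₂ ∘ p → q [ h₂ ]t ≅ₜ q {A = E [ g₂ ]T}
           → h₁ ≅ₕ h₂
  ▹-ext-≅ₕ refl hrefl hrefl h₁ h₂ p₁ q₁ p₂ q₂ =
    ≡⇒≅ₕ (▹-ext h₁ h₂ (trans p₁ (sym p₂)) (≅ₜ-trans q₁ (≅ₜ-sym q₂)))

  [∘]Tel : ∀ {Γ Θ Ξ} (Δ : Tele Γ) (σ : Hom Θ Γ) (ρ : Hom Ξ Θ)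
         → Δ [ σ ∘ ρ ]Tel ≡ (Δ [ σ ]Tel) [ ρ ]Tel
  lift-∘ : ∀ {Γ Θ Ξ} (Δ : Tele Γ) (σ : Hom Θ Γ) (ρ : Hom Ξ Θ)
         → lift Δ (σ ∘ ρ) ≅ₕ lift Δ σ ∘ lift (Δ [ σ ]Tel) ρ

  [∘]Tel []       σ ρ = refl
  [∘]Tel (Δ ,, A) σ ρ =
    ,,-cong ([∘]Tel Δ σ ρ) (≅ₕ-trans (∘-cong-≅ₕ hrefl (lift-∘ Δ σ ρ)) (≡⇒≅ₕ (sym assoc)))

  lift-∘ []       σ ρ = hrefl
  lift-∘ (Δ ,, A) σ ρ =
    ▹-ext-≅ₕ ([∘]Tel Δ σ ρ) (≅ₕ-trans (∘-cong-≅ₕ hrefl (lift-∘ Δ σ ρ)) (≡⇒≅ₕ (sym assoc)))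
      (lift-∘ Δ σ ρ) (lift (Δ ,, A) (σ ∘ ρ)) (lift (Δ ,, A) σ ∘ lift ((Δ ,, A) [ σ ]Tel) ρ)
      (p∘lift Δ A (σ ∘ ρ)) (q[lift] Δ A (σ ∘ ρ)) p∘lift∘lift
      (≅ₜ-trans ([∘]t-≅ₜ q _ _)
        (≅ₜ-trans ([]t-cong (q[lift] Δ A σ) hrefl) (q[lift] (Δ [ σ ]Tel) Aσ ρ)))
    where
    Aσ = CwFStr._[_]T (LocalUniverse C) A (lift Δ σ)
    p∘lift∘lift : p ∘ (lift (Δ ,, A) σ ∘ lift ((Δ ,, A) [ σ ]Tel) ρ)
                ≡ (lift Δ σ ∘ lift (Δ [ σ ]Tel) ρ) ∘ p
    p∘lift∘lift = begin
      p ∘ (lift (Δ ,, A) σ ∘ liftσρ)           ≡⟨ sym assoc ⟩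
      (p ∘ lift (Δ ,, A) σ) ∘ liftσρ           ≡⟨ cong (_∘ liftσρ) (p∘lift Δ A σ) ⟩
      (lift Δ σ ∘ p) ∘ liftσρ                  ≡⟨ assoc ⟩
      lift Δ σ ∘ (p ∘ liftσρ)                  ≡⟨ cong (lift Δ σ ∘_) (p∘lift (Δ [ σ ]Tel) Aσ ρ) ⟩
      lift Δ σ ∘ (lift (Δ [ σ ]Tel) ρ ∘ p)     ≡⟨ sym assoc ⟩
      (lift Δ σ ∘ lift (Δ [ σ ]Tel) ρ) ∘ p     ∎
      where
      open ≡-Reasoning
      liftσρ = lift ((Δ ,, A) [ σ ]Tel) ρ

-- Elements of monomial sorts over Γ, compared across different sorts; this is
-- how transport along the naturality equations of polynomial sorts is handled.

module MonomialElements {ℓ} (C : CwF ℓ) where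
  open CwF C
  open CwFStr str
  open CwFEquality C
  open Telescopes C
  open Poly (LocalUniverse C)

  MonoEl : Ctx → Set ℓ
  MonoEl Γ = Σ (Mono Γ) Els

  infix 4 _≡ₑ_
  _≡ₑ_ : ∀ {Γ} → MonoEl Γ → MonoEl Γ → Set ℓ
  _≡ₑ_ = _≡_

  infixl 8 _[_]ₑ
  _[_]ₑ : ∀ {Γ Θ} → MonoEl Γ → Hom Θ Γ → MonoEl Θ
  (K , x) [ σ ]ₑ = K [ σ ]M , _[_]E {M = K} x σ

  subst-Els : ∀ {Γ} {K K' : Mono Γ} (e : K ≡ K') (x : Els K) → (K' , subst Els e x) ≡ₑ (K , x)
  subst-Els refl x = refl

  ty-el-≡ : ∀ {Ξ V} {E : Ty V} {D D' : Tele Ξ} {g : Hom (Ξ ▹▹ D) V} {g' : Hom (Ξ ▹▹ D') V}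
          → D ≡ D' → g ≅ₕ g' → (ty D , ltyp V E g) ≡ₑ (ty D' , ltyp V E g')
  ty-el-≡ refl hrefl = refl

  tm-el-≡ : ∀ {Ξ V} {E : Ty V} {D D' : Tele Ξ} {g : Hom (Ξ ▹▹ D) V} {g' : Hom (Ξ ▹▹ D') V}
              {y : Tm (Ξ ▹▹ D) (E [ g ]T)} {y' : Tm (Ξ ▹▹ D') (E [ g' ]T)}
          → D ≡ D' → g ≅ₕ g' → y ≅ₜ y' → (tm D (ltyp V E g) , y) ≡ₑ (tm D' (ltyp V E g') , y')
  tm-el-≡ refl hrefl hrefl = refl

  ty-el-≡⁻¹ : ∀ {Γ V V'} {E : Ty V} {E' : Ty V'} {D D' : Tele Γ}
                {a : Hom (Γ ▹▹ D) V} {a' : Hom (Γ ▹▹ D') V'}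
            → (ty D , ltyp V E a) ≡ₑ (ty D' , ltyp V' E' a') → a ≅ₕ a'
  ty-el-≡⁻¹ refl = hrefl

  tm-el-≡⁻¹ : ∀ {Γ V V'} {E : Ty V} {E' : Ty V'} {D D' : Tele Γ}
                {a : Hom (Γ ▹▹ D) V} {a' : Hom (Γ ▹▹ D') V'}
                {y : Tm (Γ ▹▹ D) (E [ a ]T)} {y' : Tm (Γ ▹▹ D') (E' [ a' ]T)}
            → (tm D (ltyp V E a) , y) ≡ₑ (tm D' (ltyp V' E' a') , y') → y ≅ₜ y'
  tm-el-≡⁻¹ refl = hrefl

  [∘]E : ∀ {Γ Θ Ξ} (K : Mono Γ) (x : Els K) (σ : Hom Θ Γ) (ρ : Hom Ξ Θ)
       → (K , x) [ σ ∘ ρ ]ₑ ≡ₑ (K , x) [ σ ]ₑ [ ρ ]ₑ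
  [∘]E (ty Δ) x σ ρ =
    ty-el-≡ ([∘]Tel Δ σ ρ) (≅ₕ-trans (∘-cong-≅ₕ hrefl (lift-∘ Δ σ ρ)) (≡⇒≅ₕ (sym assoc)))
  [∘]E (tm Δ A) x σ ρ =
    tm-el-≡ ([∘]Tel Δ σ ρ) (≅ₕ-trans (∘-cong-≅ₕ hrefl (lift-∘ Δ σ ρ)) (≡⇒≅ₕ (sym assoc)))
      (≅ₜ-trans (subst-≅ₜ _ _) (≅ₜ-trans ([]t-cong (hrefl {a = x}) (lift-∘ Δ σ ρ))
        (≅ₜ-trans ([∘]t-≅ₜ x _ _) (≅ₜ-trans ([]t-cong (≅ₜ-sym (subst-≅ₜ _ _)) hrefl)
          (≅ₜ-sym (subst-≅ₜ _ _))))))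

  module _ {P : PolySort} {M : ∀ {Γ} → Elem P Γ → Mono Γ} {Γ} {e e' : Elem P Γ}
           {m : Els (M e)} {m' : Els (M e')} where

    ext-el-≡ : e ≡ e' → (M e , m) ≡ₑ (M e' , m')
             → _≡_ {A = Σ (Elem P Γ) (λ e → Els (M e))} (e , m) (e' , m')
    ext-el-≡ refl refl = refl

    ext-el-≡⁻¹ : _≡_ {A = Σ (Elem P Γ) (λ e → Els (M e))} (e , m) (e' , m')
               → (M e , m) ≡ₑ (M e' , m')
    ext-el-≡⁻¹ refl = refl

  act-∘ : ∀ (P : PolySort) {Γ Θ Ξ} (x : Elem P Γ) (σ : Hom Θ Γ) (ρ : Hom Ξ Θ)
        → act P (act P x σ) ρ ≡ act P x (σ ∘ ρ)
  act-∘ ◆ x σ ρ = refl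
  act-∘ (ext P M nat) (e , m) σ ρ = ext-el-≡ {P = P} {M = M} (act-∘ P e σ ρ) (begin
    (M (act P (act P e σ) ρ) , subst Els (sym (nat (act P e σ) ρ)) (_[_]E {M = M (act P e σ)} mσ ρ))
      ≡⟨ subst-Els (sym (nat (act P e σ) ρ)) _ ⟩
    (M (act P e σ) , mσ) [ ρ ]ₑ
      ≡⟨ cong _[ ρ ]ₑ (subst-Els (sym (nat e σ)) _) ⟩
    (M e , m) [ σ ]ₑ [ ρ ]ₑ
      ≡⟨ sym ([∘]E (M e) m σ ρ) ⟩
    (M e , m) [ σ ∘ ρ ]ₑ
      ≡⟨ sym (subst-Els (sym (nat e (σ ∘ ρ))) _) ⟩
    (M (act P e (σ ∘ ρ)) , subst Els (sym (nat e (σ ∘ ρ))) (_[_]E {M = M e} m (σ ∘ ρ))) ∎)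
    where
    open ≡-Reasoning
    mσ = subst Els (sym (nat e σ)) (_[_]E {M = M e} m σ)

module Shapes {ℓ} (C : CwF ℓ) where
  open CwF C
  open CwFStr str
  open Poly (LocalUniverse C)
  open MonomialElements C

  data Kind : Set where
    type term : Kind

  kind : ∀ {Γ} → Mono Γ → Kind
  kind (ty _)   = type
  kind (tm _ _) = term

  Shape : Kind → Set ℓ
  Shape type = Σ Ctx Ty
  Shape term = ⊤

  KindedShape : Set ℓ
  KindedShape = Σ Kind Shape

  shape : ∀ {Γ} (K : Mono Γ) → Els K → Shape (kind K)
  shape (ty Δ)   x = LTy.V x , LTy.E x
  shape (tm Δ A) x = tt

  -- shape (N [ σ ]M) x, typed by kind N: kind (N [ σ ]M) only reduces to it
  -- after case analysis on N.
  shape-at : ∀ {Γ T} (N : Mono T) (σ : Hom Γ T) → Els (N [ σ ]M) → Shape (kind N)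
  shape-at (ty Δ)   σ x = LTy.V x , LTy.E x
  shape-at (tm Δ A) σ x = tt

  kindedShape : ∀ {Γ} → MonoEl Γ → KindedShape
  kindedShape (K , x) = kind K , shape K x

  shape-at≡shape : ∀ {Γ T} (N : Mono T) (σ : Hom Γ T) (x : Els (N [ σ ]M))
                 → (kind N , shape-at N σ x) ≡ kindedShape (N [ σ ]M , x)
  shape-at≡shape (ty Δ)   σ x = refl
  shape-at≡shape (tm Δ A) σ x = refl

  kindedShape-[]ₑ : ∀ {Γ Θ} (K : Mono Γ) (x : Els K) (σ : Hom Θ Γ)
                  → kindedShape ((K , x) [ σ ]ₑ) ≡ kindedShape (K , x)
  kindedShape-[]ₑ (ty Δ)   x σ = refl
  kindedShape-[]ₑ (tm Δ A) x σ = refl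

  record Generic {T} (N : Mono T) (s : Shape (kind N)) : Set ℓ where
    field
      Base    : Ctx
      π       : Hom Base T
      generic : Els (N [ π ]M)
      classify : ∀ {Γ} (σ : Hom Γ T) (x : Els (N [ σ ]M)) → shape-at N σ x ≡ s
               → Σ (Hom Γ Base) λ ρ → (π ∘ ρ ≡ σ)
                 × (N [ π ]M , generic) [ ρ ]ₑ ≡ₑ (N [ σ ]M , x)
      classify-unique : ∀ {Γ} (σ : Hom Γ T) (x : Els (N [ σ ]M)) (x-s : shape-at N σ x ≡ s)
                        (ρ : Hom Γ Base) → π ∘ ρ ≡ σ
                      → (N [ π ]M , generic) [ ρ ]ₑ ≡ₑ (N [ σ ]M , x)
                      → ρ ≡ proj₁ (classify σ x x-s)

module Terminals {ℓ} (C : CwF ℓ) where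
  open CwF C
  open CwFStr str
  open Poly (LocalUniverse C)
  open MonomialElements C
  open Shapes C

  Terminalsᴾ : PolySort → Set ℓ
  Terminalsᴾ P = ComponentTerminals Hom (Elem P) (act P)

  ◆-terminals : Terminalsᴾ ◆
  ◆-terminals = record
    { terminal          = λ _ → ◇ , tt
    ; toTerminal        = λ _ → ! , refl
    ; toTerminal-unique = λ _ f → !-η (proj₁ f)
    ; terminal-resp     = λ _ → refl
    }

  module _ (generics : ∀ {T} (N : Mono T) (s : Shape (kind N)) → Generic N s) where

    module Extension (P : PolySort) (M : ∀ {Γ} → Elem P Γ → Mono Γ)
                     (nat : ∀ {Γ Δ} (e : Elem P Γ) (σ : Hom Δ Γ) → M (act P e σ) ≡ M e [ σ ]M)
                     (terminalsP : Terminalsᴾ P) where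
      open ComponentTerminals terminalsP
      Q : PolySort
      Q = ext P M nat

      Component : Set ℓ
      Component = Σ (Elt Hom (Elem P) (act P)) λ x → Shape (kind (M (proj₂ x)))

      component-≡ : ∀ {x y} {s : Shape (kind (M (proj₂ x)))} {s' : Shape (kind (M (proj₂ y)))} → x ≡ y
                  → _≡_ {A = KindedShape} (kind (M (proj₂ x)) , s) (kind (M (proj₂ y)) , s')
                  → _≡_ {A = Component} (x , s) (y , s')
      component-≡ refl refl = refl

      generic-of : Component → Elt Hom (Elem Q) (act Q)
      generic-of ((T , t) , s) = Base , (act P t π , subst Els (sym (nat t π)) generic)
        where open Generic (generics (M t) s)

      module Over (Γ : Ctx) (e : Elem P Γ) (m : Els (M e)) where
        T : Ctx
        T = proj₁ (terminal (Γ , e))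
        t : Elem P T
        t = proj₂ (terminal (Γ , e))
        σ : Hom Γ T
        σ = proj₁ (toTerminal (Γ , e))
        t[σ]≡e : act P t σ ≡ e
        t[σ]≡e = proj₂ (toTerminal (Γ , e))
        M-eq : M e ≡ M t [ σ ]M
        M-eq = trans (cong M (sym t[σ]≡e)) (nat t σ)
        mₜ : Els (M t [ σ ]M)
        mₜ = subst Els M-eq m
        s : Shape (kind (M t))
        s = shape-at (M t) σ mₜ
        open Generic (generics (M t) s) public
        component : Component
        component = terminal (Γ , e) , s
        component-shape : (kind (M t) , s) ≡ kindedShape (M e , m)
        component-shape = trans (shape-at≡shape (M t) σ mₜ) (cong kindedShape (subst-Els M-eq m))

        generic-act : ∀ {Θ} (ρ : Hom Θ Base)
                    → let (e' , m') = act Q (proj₂ (generic-of component)) ρ in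
                      (M e' , m') ≡ₑ (M t [ π ]M , generic) [ ρ ]ₑ
        generic-act ρ = trans (subst-Els (sym (nat (act P t π) ρ)) _)
                              (cong _[ ρ ]ₑ (subst-Els (sym (nat t π)) generic))

      terminalQ : Elt Hom (Elem Q) (act Q) → Elt Hom (Elem Q) (act Q)
      terminalQ (Γ , (e , m)) = generic-of (Over.component Γ e m)

      toTerminalQ : ∀ x → EltHom Hom (Elem Q) (act Q) x (terminalQ x)
      toTerminalQ (Γ , (e , m)) = ρ , ext-el-≡ {P = P} {M = M}
          (trans (act-∘ P t π ρ) (trans (cong (act P t) π∘ρ≡σ) t[σ]≡e))
          (trans (generic-act ρ) (trans generic[ρ]≡mₜ (subst-Els M-eq m)))
        where
        open Over Γ e m
        classified : Σ (Hom Γ Base) λ ρ → (π ∘ ρ ≡ σ) × (M t [ π ]M , generic) [ ρ ]ₑ ≡ₑ (M t [ σ ]M , mₜ)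
        classified = classify σ mₜ refl
        ρ : Hom Γ Base
        ρ = proj₁ classified
        π∘ρ≡σ : π ∘ ρ ≡ σ
        π∘ρ≡σ = proj₁ (proj₂ classified)
        generic[ρ]≡mₜ : (M t [ π ]M , generic) [ ρ ]ₑ ≡ₑ (M t [ σ ]M , mₜ)
        generic[ρ]≡mₜ = proj₂ (proj₂ classified)

      toTerminalQ-unique : ∀ x (f : EltHom Hom (Elem Q) (act Q) x (terminalQ x))
                         → proj₁ f ≡ proj₁ (toTerminalQ x)
      toTerminalQ-unique (Γ , (e , m)) (ρ , ρ-eq) = classify-unique σ mₜ refl ρ π∘ρ≡σ
          (trans (sym (generic-act ρ))
                 (trans (ext-el-≡⁻¹ {P = P} {M = M} ρ-eq) (sym (subst-Els M-eq m))))
        where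
        open Over Γ e m
        π∘ρ≡σ : π ∘ ρ ≡ σ
        π∘ρ≡σ = toTerminal-unique (Γ , e) (π ∘ ρ , trans (sym (act-∘ P t π ρ)) (cong proj₁ ρ-eq))

      terminalQ-resp : ∀ {x y} → EltHom Hom (Elem Q) (act Q) x y → terminalQ x ≡ terminalQ y
      terminalQ-resp {Γ , (e , m)} {Γ' , (e' , m')} (ρ , ρ-eq) = cong generic-of (component-≡
          (terminal-resp (ρ , cong proj₁ ρ-eq))
          (begin
            (kind (M (Over.t Γ e m)) , Over.s Γ e m)
              ≡⟨ Over.component-shape Γ e m ⟩
            kindedShape (M e , m)
              ≡⟨ cong kindedShape (sym (ext-el-≡⁻¹ {P = P} {M = M} ρ-eq)) ⟩
            kindedShape (M (act P e' ρ) , subst Els (sym (nat e' ρ)) (_[_]E {M = M e'} m' ρ))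
              ≡⟨ cong kindedShape (subst-Els (sym (nat e' ρ)) _) ⟩
            kindedShape ((M e' , m') [ ρ ]ₑ)
              ≡⟨ kindedShape-[]ₑ (M e') m' ρ ⟩
            kindedShape (M e' , m')
              ≡⟨ sym (Over.component-shape Γ' e' m') ⟩
            (kind (M (Over.t Γ' e' m')) , Over.s Γ' e' m') ∎))
        where open ≡-Reasoning

      terminals : Terminalsᴾ Q
      terminals = record
        { terminal          = terminalQ
        ; toTerminal        = toTerminalQ
        ; toTerminal-unique = toTerminalQ-unique
        ; terminal-resp     = terminalQ-resp
        }

    polySort-terminals : (P : PolySort) → Terminalsᴾ P
    polySort-terminals ◆             = ◆-terminals
    polySort-terminals (ext P M nat) = Extension.terminals P M nat (polySort-terminals P)

module DependentExponentials {ℓ} (C : CwF ℓ) where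
  open CwF C
  open CwFStr str
  open CwFEquality C
  open Cat str
  open Poly (LocalUniverse C)
  open Telescopes C

  record DepExp {X Y Z} (f : Hom Y X) (g : Hom Z Y) : Set ℓ where
    field
      Π        : Ctx
      π        : Hom Π X
      PB       : Ctx
      u        : Hom PB Π
      v        : Hom PB Y
      pullback : IsPullback f π u v
      ev       : Hom PB Z
      g∘ev     : g ∘ ev ≡ v
      universal : ∀ {W} (h' : Hom W X) {P} (u' : Hom P W) (v' : Hom P Y)
                → IsPullback f h' u' v' → (k : Hom P Z) → g ∘ k ≡ v'
                → Unique (λ (h : Hom W Π) →
                     (π ∘ h ≡ h') × (∀ (m : Hom P PB) → u ∘ m ≡ h ∘ u' → v ∘ m ≡ v' → ev ∘ m ≡ k))

  depExp : ∀ {X Y Z} {f : Hom Y X} {g : Hom Z Y} → HasDepExp f g → DepExp f g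
  depExp (Π , π , PB , u , v , pullback , ev , g∘ev , universal) =
    record { Π = Π ; π = π ; PB = PB ; u = u ; v = v ; pullback = pullback
           ; ev = ev ; g∘ev = g∘ev ; universal = universal }

  -- Since Γ.Δ[σ] is the pullback of p_Δ along σ, maps ρ : Γ → Π over σ
  -- correspond to maps k : Γ.Δ[σ] → Z over lift Δ σ.
  module OverTelescope {T} (Δ : Tele T) {Z} (g : Hom Z (T ▹▹ Δ)) (D : DepExp (pTele Δ) g) where
    open DepExp D public

    private
      comparison-unique : Unique (λ (m : Hom (Π ▹▹ (Δ [ π ]Tel)) PB)
                                   → (u ∘ m ≡ pTele (Δ [ π ]Tel)) × (v ∘ m ≡ lift Δ π))
      comparison-unique = proj₂ pullback (pTele (Δ [ π ]Tel)) (lift Δ π) (proj₁ (lift-pullback Δ π))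

    comparison : Hom (Π ▹▹ (Δ [ π ]Tel)) PB
    comparison = proj₁ comparison-unique

    u∘comparison : u ∘ comparison ≡ pTele (Δ [ π ]Tel)
    u∘comparison = proj₁ (proj₁ (proj₂ comparison-unique))

    v∘comparison : v ∘ comparison ≡ lift Δ π
    v∘comparison = proj₂ (proj₁ (proj₂ comparison-unique))

    module _ {Γ} (σ : Hom Γ T) where

      Δ[π][ρ]≡Δ[σ] : ∀ {ρ : Hom Γ Π} → π ∘ ρ ≡ σ → (Δ [ π ]Tel) [ ρ ]Tel ≡ Δ [ σ ]Tel
      Δ[π][ρ]≡Δ[σ] {ρ} π∘ρ≡σ = trans (sym ([∘]Tel Δ π ρ)) (cong (Δ [_]Tel) π∘ρ≡σ)

      liftOver : ∀ (ρ : Hom Γ Π) → π ∘ ρ ≡ σ → Hom (Γ ▹▹ (Δ [ σ ]Tel)) (Π ▹▹ (Δ [ π ]Tel))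
      liftOver ρ π∘ρ≡σ = subst (λ D → Hom (Γ ▹▹ D) _) (Δ[π][ρ]≡Δ[σ] π∘ρ≡σ) (lift (Δ [ π ]Tel) ρ)

      liftOver-≅ₕ : ∀ (ρ : Hom Γ Π) (π∘ρ≡σ : π ∘ ρ ≡ σ) → liftOver ρ π∘ρ≡σ ≅ₕ lift (Δ [ π ]Tel) ρ
      liftOver-≅ₕ ρ π∘ρ≡σ = subst-dom-≅ₕ (Γ ▹▹_) (Δ[π][ρ]≡Δ[σ] π∘ρ≡σ) _

      pairing : ∀ (ρ : Hom Γ Π) → π ∘ ρ ≡ σ → Hom (Γ ▹▹ (Δ [ σ ]Tel)) PB
      pairing ρ π∘ρ≡σ = comparison ∘ liftOver ρ π∘ρ≡σ

      u∘pairing : ∀ ρ (π∘ρ≡σ : π ∘ ρ ≡ σ) → u ∘ pairing ρ π∘ρ≡σ ≡ ρ ∘ pTele (Δ [ σ ]Tel)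
      u∘pairing ρ π∘ρ≡σ = ≅ₕ⇒≡
        (≅ₕ-trans (≡⇒≅ₕ (sym assoc)) (≅ₕ-trans (∘-cong-≅ₕ (≡⇒≅ₕ u∘comparison) (liftOver-≅ₕ ρ π∘ρ≡σ))
        (≅ₕ-trans (≡⇒≅ₕ (sym (proj₁ (lift-pullback (Δ [ π ]Tel) ρ))))
                  (∘-cong-≅ₕ hrefl (pTele-cong (Δ[π][ρ]≡Δ[σ] π∘ρ≡σ))))))

      v∘pairing : ∀ ρ (π∘ρ≡σ : π ∘ ρ ≡ σ) → v ∘ pairing ρ π∘ρ≡σ ≡ lift Δ σ
      v∘pairing ρ π∘ρ≡σ = ≅ₕ⇒≡
        (≅ₕ-trans (≡⇒≅ₕ (sym assoc)) (≅ₕ-trans (∘-cong-≅ₕ (≡⇒≅ₕ v∘comparison) (liftOver-≅ₕ ρ π∘ρ≡σ))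
        (≅ₕ-trans (≅ₕ-sym (lift-∘ Δ π ρ)) (lift-cong Δ π∘ρ≡σ))))

      module _ (k : Hom (Γ ▹▹ (Δ [ σ ]Tel)) Z) (g∘k : g ∘ k ≡ lift Δ σ) where
        private
          transposeᵘ : Unique (λ (ρ : Hom Γ Π) → (π ∘ ρ ≡ σ)
                                × (∀ m → u ∘ m ≡ ρ ∘ pTele (Δ [ σ ]Tel) → v ∘ m ≡ lift Δ σ → ev ∘ m ≡ k))
          transposeᵘ = universal σ (pTele (Δ [ σ ]Tel)) (lift Δ σ) (lift-pullback Δ σ) k g∘k

        transpose : Hom Γ Π
        transpose = proj₁ transposeᵘ

        π∘transpose : π ∘ transpose ≡ σ
        π∘transpose = proj₁ (proj₁ (proj₂ transposeᵘ))

        ev∘pairing-transpose : ev ∘ pairing transpose π∘transpose ≡ k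
        ev∘pairing-transpose =
          proj₂ (proj₁ (proj₂ transposeᵘ)) (pairing transpose π∘transpose)
                (u∘pairing transpose π∘transpose) (v∘pairing transpose π∘transpose)

        transpose-unique : ∀ ρ (π∘ρ≡σ : π ∘ ρ ≡ σ) → ev ∘ pairing ρ π∘ρ≡σ ≡ k → ρ ≡ transpose
        transpose-unique ρ π∘ρ≡σ ev∘pairing≡k = proj₂ (proj₂ transposeᵘ) ρ (π∘ρ≡σ , ev-agrees)
          where
          square : π ∘ (ρ ∘ pTele (Δ [ σ ]Tel)) ≡ pTele Δ ∘ lift Δ σ
          square = trans (sym assoc) (trans (cong (_∘ pTele (Δ [ σ ]Tel)) π∘ρ≡σ) (proj₁ (lift-pullback Δ σ)))
          into-PB : Unique (λ (m : Hom (Γ ▹▹ (Δ [ σ ]Tel)) PB)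
                              → (u ∘ m ≡ ρ ∘ pTele (Δ [ σ ]Tel)) × (v ∘ m ≡ lift Δ σ))
          into-PB = proj₂ pullback (ρ ∘ pTele (Δ [ σ ]Tel)) (lift Δ σ) square
          ev-agrees : ∀ (m : Hom (Γ ▹▹ (Δ [ σ ]Tel)) PB)
                    → u ∘ m ≡ ρ ∘ pTele (Δ [ σ ]Tel) → v ∘ m ≡ lift Δ σ → ev ∘ m ≡ k
          ev-agrees m u∘m v∘m = trans (cong (ev ∘_) (trans (proj₂ (proj₂ into-PB) m (u∘m , v∘m))
            (sym (proj₂ (proj₂ into-PB) (pairing ρ π∘ρ≡σ) (u∘pairing ρ π∘ρ≡σ , v∘pairing ρ π∘ρ≡σ)))))
            ev∘pairing≡k

module Generics {ℓ} (C : CwF ℓ) (lf : Cat.LF (CwF.str C)) where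
  open CwF C
  open CwFStr str
  open CwFEquality C
  open Cat str
  open Poly (LocalUniverse C)
  open Telescopes C
  open MonomialElements C
  open Shapes C
  open DependentExponentials C

  -- A local universe χ : Γ.Δ[σ] → V is a map into T.Δ × V over lift Δ σ.
  module TypeSort {T} (Δ : Tele T) (V : Ctx) (E : Ty V) where
    private
      ΔV : Ctx
      ΔV = proj₁ (proj₂ (proj₁ lf) (T ▹▹ Δ) V)
      pr₁ : Hom ΔV (T ▹▹ Δ)
      pr₁ = proj₁ (proj₂ (proj₂ (proj₁ lf) (T ▹▹ Δ) V))
      pr₂ : Hom ΔV V
      pr₂ = proj₁ (proj₂ (proj₂ (proj₂ (proj₁ lf) (T ▹▹ Δ) V)))
      isProduct : IsProduct pr₁ pr₂
      isProduct = proj₂ (proj₂ (proj₂ (proj₂ (proj₁ lf) (T ▹▹ Δ) V)))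

    open OverTelescope Δ pr₁
      (depExp (proj₂ lf (pTele Δ) pr₁ (dispTele Δ , refl) (inj₂ (V , pr₂ , isProduct))))

    genericTy : LTy C (Π ▹▹ (Δ [ π ]Tel))
    genericTy = ltyp V E (pr₂ ∘ ev ∘ comparison)

    genericTy[ρ] : ∀ {Γ} (σ : Hom Γ T) ρ (π∘ρ≡σ : π ∘ ρ ≡ σ)
                 → (pr₂ ∘ ev ∘ comparison) ∘ lift (Δ [ π ]Tel) ρ ≅ₕ pr₂ ∘ (ev ∘ pairing σ ρ π∘ρ≡σ)
    genericTy[ρ] σ ρ π∘ρ≡σ = ≅ₕ-trans (∘-cong-≅ₕ hrefl (≅ₕ-sym (liftOver-≅ₕ σ ρ π∘ρ≡σ)))
                                     (≡⇒≅ₕ (trans assoc assoc))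

    module _ {Γ} (σ : Hom Γ T) (χ : Hom (Γ ▹▹ (Δ [ σ ]Tel)) V) where
      private
        pairᵘ : Unique (λ (m : Hom (Γ ▹▹ (Δ [ σ ]Tel)) ΔV) → (pr₁ ∘ m ≡ lift Δ σ) × (pr₂ ∘ m ≡ χ))
        pairᵘ = isProduct (lift Δ σ) χ

      ⟨lift,χ⟩ : Hom (Γ ▹▹ (Δ [ σ ]Tel)) ΔV
      ⟨lift,χ⟩ = proj₁ pairᵘ

      pr₁∘⟨lift,χ⟩ : pr₁ ∘ ⟨lift,χ⟩ ≡ lift Δ σ
      pr₁∘⟨lift,χ⟩ = proj₁ (proj₁ (proj₂ pairᵘ))

      pr₂∘⟨lift,χ⟩ : pr₂ ∘ ⟨lift,χ⟩ ≡ χ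
      pr₂∘⟨lift,χ⟩ = proj₂ (proj₁ (proj₂ pairᵘ))

      ⟨lift,χ⟩-unique : ∀ m → (pr₁ ∘ m ≡ lift Δ σ) × (pr₂ ∘ m ≡ χ) → m ≡ ⟨lift,χ⟩
      ⟨lift,χ⟩-unique = proj₂ (proj₂ pairᵘ)

    classifyTy : ∀ {Γ} (σ : Hom Γ T) (x : LTy C (Γ ▹▹ (Δ [ σ ]Tel))) → shape-at (ty Δ) σ x ≡ (V , E)
               → Σ (Hom Γ Π) λ ρ → (π ∘ ρ ≡ σ)
                 × (ty Δ [ π ]M , genericTy) [ ρ ]ₑ ≡ₑ (ty Δ [ σ ]M , x)
    classifyTy {Γ} σ (ltyp .V .E χ) refl = ρ , π∘ρ≡σ , ty-el-≡ (Δ[π][ρ]≡Δ[σ] σ π∘ρ≡σ)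
        (≅ₕ-trans (genericTy[ρ] σ ρ π∘ρ≡σ)
                  (≡⇒≅ₕ (trans (cong (pr₂ ∘_) (ev∘pairing-transpose σ k g∘k)) (pr₂∘⟨lift,χ⟩ σ χ))))
      where
      k : Hom (Γ ▹▹ (Δ [ σ ]Tel)) ΔV
      k = ⟨lift,χ⟩ σ χ
      g∘k : pr₁ ∘ k ≡ lift Δ σ
      g∘k = pr₁∘⟨lift,χ⟩ σ χ
      ρ : Hom Γ Π
      ρ = transpose σ k g∘k
      π∘ρ≡σ : π ∘ ρ ≡ σ
      π∘ρ≡σ = π∘transpose σ k g∘k

    classifyTy-unique : ∀ {Γ} (σ : Hom Γ T) (x : LTy C (Γ ▹▹ (Δ [ σ ]Tel))) (x-s : shape-at (ty Δ) σ x ≡ (V , E))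
                        (ρ : Hom Γ Π) → π ∘ ρ ≡ σ
                      → (ty Δ [ π ]M , genericTy) [ ρ ]ₑ ≡ₑ (ty Δ [ σ ]M , x)
                      → ρ ≡ proj₁ (classifyTy σ x x-s)
    classifyTy-unique σ (ltyp .V .E χ) refl ρ π∘ρ≡σ generic[ρ]≡x =
      transpose-unique σ (⟨lift,χ⟩ σ χ) (pr₁∘⟨lift,χ⟩ σ χ) ρ π∘ρ≡σ
        (⟨lift,χ⟩-unique σ χ (ev ∘ pairing σ ρ π∘ρ≡σ)
          (trans (sym assoc) (trans (cong (_∘ pairing σ ρ π∘ρ≡σ) g∘ev) (v∘pairing σ ρ π∘ρ≡σ)) ,
           ≅ₕ⇒≡ (≅ₕ-trans (≅ₕ-sym (genericTy[ρ] σ ρ π∘ρ≡σ)) (ty-el-≡⁻¹ generic[ρ]≡x))))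

    generic : Generic (ty Δ) (V , E)
    generic = record { Base = Π ; π = π ; generic = genericTy
                     ; classify = classifyTy ; classify-unique = classifyTy-unique }

  -- A term of E[χ] over Γ.Δ[σ] is a section of p_{E[χ]} over lift Δ σ.
  module TermSort {T} (Δ : Tele T) (V : Ctx) (E : Ty V) (χ : Hom (T ▹▹ Δ) V) where
    N : Mono T
    N = tm Δ (ltyp V E χ)

    open OverTelescope Δ (p {A = E [ χ ]T})
      (depExp (proj₂ lf (pTele Δ) p (dispTele Δ , refl) (inj₁ (step done (E [ χ ]T) , idl))))

    p∘ev∘comparison : p ∘ (ev ∘ comparison) ≡ lift Δ π
    p∘ev∘comparison = trans (sym assoc) (trans (cong (_∘ comparison) g∘ev) v∘comparison)

    genericTm : Els (N [ π ]M)
    genericTm = subst (Tm _) q-type (q [ ev ∘ comparison ]t)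
      where
      q-type : E [ χ ]T [ p ]T [ ev ∘ comparison ]T ≡ E [ χ ∘ lift Δ π ]T
      q-type = trans (sym [∘]T) (trans (cong (E [ χ ]T [_]T) p∘ev∘comparison) (sym [∘]T))

    module _ {Γ} (σ : Hom Γ T) where
      χ-over : ∀ ρ (π∘ρ≡σ : π ∘ ρ ≡ σ) → (χ ∘ lift Δ π) ∘ lift (Δ [ π ]Tel) ρ ≅ₕ χ ∘ lift Δ σ
      χ-over ρ π∘ρ≡σ =
        ≅ₕ-trans (≡⇒≅ₕ assoc) (∘-cong-≅ₕ hrefl (≅ₕ-trans (≅ₕ-sym (lift-∘ Δ π ρ)) (lift-cong Δ π∘ρ≡σ)))

      genericTm[ρ] : ∀ ρ (π∘ρ≡σ : π ∘ ρ ≡ σ)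
                   → _[_]E {M = N [ π ]M} genericTm ρ ≅ₜ q [ ev ∘ pairing σ ρ π∘ρ≡σ ]t
      genericTm[ρ] ρ π∘ρ≡σ =
        ≅ₜ-trans (subst-≅ₜ _ _) (≅ₜ-trans ([]t-cong (subst-≅ₜ _ _) hrefl) (≅ₜ-trans (≅ₜ-sym ([∘]t-≅ₜ q _ _))
          ([]t-cong hrefl (≅ₕ-trans (∘-cong-≅ₕ hrefl (≅ₕ-sym (liftOver-≅ₕ σ ρ π∘ρ≡σ))) (≡⇒≅ₕ assoc)))))

      module _ (x : Els (N [ σ ]M)) where
        section : Hom (Γ ▹▹ (Δ [ σ ]Tel)) ((T ▹▹ Δ) ▹ E [ χ ]T)
        section = ⟨ lift Δ σ , subst (Tm _) [∘]T x ⟩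

        p∘section : p ∘ section ≡ lift Δ σ
        p∘section = p∘⟨⟩ _ _

        q[section] : q [ section ]t ≅ₜ x
        q[section] = ≅ₜ-trans (q[⟨⟩]-≅ₜ _ _) (subst-≅ₜ _ _)

        classifyTm : shape-at N σ x ≡ tt
                   → Σ (Hom Γ Π) λ ρ → (π ∘ ρ ≡ σ)
                     × (N [ π ]M , genericTm) [ ρ ]ₑ ≡ₑ (N [ σ ]M , x)
        classifyTm _ = ρ , π∘ρ≡σ , tm-el-≡ (Δ[π][ρ]≡Δ[σ] σ π∘ρ≡σ) (χ-over ρ π∘ρ≡σ)
            (≅ₜ-trans (genericTm[ρ] ρ π∘ρ≡σ)
              (≅ₜ-trans ([]t-cong hrefl (≡⇒≅ₕ (ev∘pairing-transpose σ section p∘section))) q[section]))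
          where
          ρ : Hom Γ Π
          ρ = transpose σ section p∘section
          π∘ρ≡σ : π ∘ ρ ≡ σ
          π∘ρ≡σ = π∘transpose σ section p∘section

        classifyTm-unique : (x-s : shape-at N σ x ≡ tt) (ρ : Hom Γ Π) → π ∘ ρ ≡ σ
                          → (N [ π ]M , genericTm) [ ρ ]ₑ ≡ₑ (N [ σ ]M , x)
                          → ρ ≡ proj₁ (classifyTm x-s)
        classifyTm-unique _ ρ π∘ρ≡σ generic[ρ]≡x = transpose-unique σ section p∘section ρ π∘ρ≡σ
          (▹-ext _ _ (trans (sym assoc) (trans (cong (_∘ pairing σ ρ π∘ρ≡σ) g∘ev)
                                               (trans (v∘pairing σ ρ π∘ρ≡σ) (sym p∘section))))
                     (≅ₜ-trans (≅ₜ-sym (genericTm[ρ] ρ π∘ρ≡σ))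
                               (≅ₜ-trans (tm-el-≡⁻¹ generic[ρ]≡x) (≅ₜ-sym q[section]))))

    generic : Generic N tt
    generic = record { Base = Π ; π = π ; generic = genericTm
                     ; classify = classifyTm ; classify-unique = classifyTm-unique }

  generics : ∀ {T} (N : Mono T) (s : Shape (kind N)) → Generic N s
  generics (ty Δ)              (V , E) = TypeSort.generic Δ V E
  generics (tm Δ (ltyp V E χ)) tt      = TermSort.generic Δ V E χ

proposition25 : ∀ {ℓ} (C : CwF ℓ) → Cat.LF (CwF.str C)
    → (P : Poly.PolySort (LocalUniverse C))
    → FamiliallyRepresentable (CwFStr.Hom (LocalUniverse C))
        (Poly.Elem (LocalUniverse C) P) (Poly.act (LocalUniverse C) P)
proposition25 C lf P =
  componentTerminals⇒familiallyRepresentable _ _ _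
    (Terminals.polySort-terminals C (Generics.generics C lf) P)
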